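{- Let $\bar\Pi=(K_7,\rho)$ be the combinatorial embedding of $K_7$ on vertex-set $\mathbb{Z}_7$ with rotation $\rho(x,y)=(x,5y-4x \bmod 7)$ for all oriented edges $(x,y)$. Its faces (obtained by face tracing) are the triangles $\{x,x+1,x+3\}$ and $\{x,x+1,x+5\}$, $x\in\mathbb{Z}_7$, and these two families of seven faces form the two color classes of a face 2-coloring. Then the group $\operatorname{Aut}(\bar\Pi,Col)$ of embedding automorphisms of $\bar\Pi$ that fix each color class is isomorphic to the Frobenius group $F_{21}$ of order 21.
   Context: For a graph $\Gamma=(\mathcal{V},\mathcal{E})$, $D(\Gamma)$ is the set of ordered pairs $(x,y),(y,x)$ for $\{x,y\}\in\mathcal{E}$, and $\mathcal{N}(\Gamma,x)$ the neighbourhood of $x$. A combinatorial embedding of a connected graph $\Gamma$ is a pair $(\Gamma,\rho)$ with $\rho:D(\Gamma)\to D(\Gamma)$ such that for each vertex $x$ there is a permutation $\rho_x$ of $\mathcal{N}(\Gamma,x)$ which is a single cycle of length $|\mathcal{N}(\Gamma,x)|$ and $\rho(x,y)=(x,\rho_x(y))$. Faces are obtained by face tracing: starting from an oriented edge $(v_0,v_1)$, set $v_{i+1}=\rho_{v_i}(v_{i-1})$ until the pair $(v_0,v_1)$ recurs; the cyclic sequence obtained is a face, and each edge $\{x,y\}$ lies in exactly two faces. An embedding automorphism of $(\Gamma,\rho)$ is a graph automorphism $\sigma$ with either $\sigma\circ\rho=\rho\circ\sigma$ on $D(\Gamma)$ or $\sigma\circ\rho=\rho^{ -1}\circ\sigma$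 on $D(\Gamma)$ (where $\sigma(x,y)=(\sigma(x),\sigma(y))$). A face 2-coloring colors faces with two colors so every edge lies in two faces of different colors; $\operatorname{Aut}(\Pi,Col)$ denotes the embedding automorphisms mapping each color class onto itself. -}

module Defs where

open import Data.Nat using (ℕ; _+_; _*_; _^_)
open import Data.Nat.DivMod using (_mod_)
open import Data.Fin using (Fin; toℕ)
open import Data.Fin.Properties using (all?) renaming (_≟_ to _≟ᶠ_)
open import Data.Fin.Subset using (Subset; ⁅_⁆; _∪_)
open import Data.Fin.Permutation using (Permutation′; _⟨$⟩ʳ_)
open import Data.Product using (Σ; _×_; _,_; ∃)
open import Relation.Binary.PropositionalEquality using (_≡_; _≢_)
open import Relation.Nullary.Decidable using (toWitness)
open import Data.Unit using (tt)
open import Function.Bundles using (_⇔_)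

V : Set
V = Fin 7

_⊕_ : V → ℕ → V
x ⊕ k = (toℕ x + k) mod 7

Adj : V → V → Set
Adj x y = x ≢ y

Dart : Set
Dart = V × V

IsDart : Dart → Set
IsDart (x , y) = Adj x y

-- The rotation  ρ_x(y) = 5y - 4x mod 7  (written as 5y + 3x, since -4 ≡ 3 mod 7)

rot : V → V → V
rot x y = (5 * toℕ y + 3 * toℕ x) mod 7

rotInv : V → V → V
rotInv x y = (3 * toℕ y + 5 * toℕ x) mod 7

rot-rotInv : ∀ x y → rot x (rotInv x y) ≡ y
rot-rotInv = toWitness {a? = all? (λ x → all? (λ y → rot x (rotInv x y) ≟ᶠ y))} tt

rotInv-rot : ∀ x y → rotInv x (rot x y) ≡ y
rotInv-rot = toWitness {a? = all? (λ x → all? (λ y → rotInv x (rot x y) ≟ᶠ y))} tt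

ρ : Dart → Dart
ρ (x , y) = (x , rot x y)

ρ⁻¹ : Dart → Dart
ρ⁻¹ (x , y) = (x , rotInv x y)

Perm : Set
Perm = Permutation′ 7

onDart : Perm → Dart → Dart
onDart σ (x , y) = (σ ⟨$⟩ʳ x , σ ⟨$⟩ʳ y)

IsGraphAut : Perm → Set
IsGraphAut σ = ∀ x y → Adj x y ⇔ Adj (σ ⟨$⟩ʳ x) (σ ⟨$⟩ʳ y)

IsEmbeddingAut : Perm → Set
IsEmbeddingAut σ =
  IsGraphAut σ ×
  ((∀ d → IsDart d → onDart σ (ρ d) ≡ ρ (onDart σ d))
   Data.Sum.⊎
   (∀ d → IsDart d → onDart σ (ρ d) ≡ ρ⁻¹ (onDart σ d)))
  where import Data.Sum

Triple : Set
Triple = V × V × V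

tri : Triple → Subset 7
tri (a , b , c) = ⁅ a ⁆ ∪ (⁅ b ⁆ ∪ ⁅ c ⁆)

famA : V → Triple
famA x = (x , x ⊕ 1 , x ⊕ 3)

famB : V → Triple
famB x = (x , x ⊕ 1 , x ⊕ 5)

InClass : (V → Triple) → Subset 7 → Set
InClass fam S = ∃ λ x → S ≡ tri (fam x)

imgTri : Perm → Triple → Subset 7
imgTri σ (a , b , c) = tri (σ ⟨$⟩ʳ a , σ ⟨$⟩ʳ b , σ ⟨$⟩ʳ c)

MapsClassOnto : Perm → (V → Triple) → Set
MapsClassOnto σ fam =
  (∀ x → InClass fam (imgTri σ (fam x))) ×
  (∀ x → ∃ λ y → imgTri σ (fam y) ≡ tri (fam x))

InAutCol : Perm → Set
InAutCol σ = IsEmbeddingAut σ × MapsClassOnto σ famA × MapsClassOnto σ famB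

-- The Frobenius group F_21 = Z_7 ⋊ Z_3, modelled as the affine maps
-- x ↦ 2^i x + b on Z_7 (i ∈ Z_3, b ∈ Z_7), with composition
-- (i , b) · (j , c) = (i + j , 2^i c + b).

F21 : Set
F21 = Fin 3 × Fin 7

_·_ : F21 → F21 → F21
(i , b) · (j , c) = ((toℕ i + toℕ j) mod 3 , (2 ^ toℕ i * toℕ c + toℕ b) mod 7)

-- group isomorphism F21 ≅ Aut(Π̄,Col) (group law on Aut: composition of
-- permutations; equality of permutations: pointwise)
IsIsoOntoAutCol : (F21 → Perm) → Set
IsIsoOntoAutCol φ =
  (∀ g → InAutCol (φ g)) ×
  (∀ g h x → φ (g · h) ⟨$⟩ʳ x ≡ φ g ⟨$⟩ʳ (φ h ⟨$⟩ʳ x)) ×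
  (∀ g h → (∀ x → φ g ⟨$⟩ʳ x ≡ φ h ⟨$⟩ʳ x) → g ≡ h) ×
  (∀ σ → InAutCol σ → ∃ λ g → ∀ x → φ g ⟨$⟩ʳ x ≡ σ ⟨$⟩ʳ x)

{-# OPTIONS --safe #-}
-- Every affine map x ↦ m x + b (m ≠ 0) of ℤ₇ commutes with the rotation, because
-- ρₓ(y) = 5y + 3x is an affine combination (5 + 3 ≡ 1 mod 7).  The colour
-- classes are the translates of the difference set {0,1,3} and of its negative
-- {0,6,4} = {0,1,5} − 1, so the multipliers preserving them are the squares
-- 1, 2, 4: this gives F₂₁.
-- Conversely ρ₀ is the 6-cycle 1 ↦ 5 ↦ 4 ↦ 6 ↦ 2 ↦ 3 on ℤ₇ ∖ {0}, so a map
-- intertwining ρ with ρ or ρ⁻¹ is determined by its values at 0 and 1; among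
-- these 2 · 42 candidates none intertwines ρ with ρ⁻¹, and those intertwining
-- ρ with itself and preserving the colours are exactly the maps of F₂₁.
module Submission where

open import Defs
open import Data.Bool.Properties using () renaming (_≟_ to _≟ᵇ_)
open import Data.Empty using (⊥-elim)
open import Data.Fin using (zero; suc; toℕ; _≟_)
open import Data.Fin.Permutation using (permutation; _⟨$⟩ʳ_)
open import Data.Fin.Properties using (all?; any?)
open import Data.Fin.Subset using (Subset)
open import Data.Nat as ℕ using (ℕ; _+_; _*_; _^_; _∸_)
open import Data.Nat.DivMod using (_mod_)
open import Data.Nat.GeneralisedArithmetic using (fold)
open import Data.Product using (∃; _,_; proj₁; proj₂)
open import Data.Product.Properties using () renaming (≡-dec to ×-≡-dec)
open import Data.Sum using (inj₁; inj₂)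
open import Data.Unit using (tt)
open import Data.Vec using ([]; _∷_; lookup)
open import Data.Vec.Properties using () renaming (≡-dec to Vec-≡-dec)
open import Function.Bundles using (Equivalence; Injection; mk⇔)
open import Function.Properties.Inverse using (↔⇒↣)
open import Relation.Binary.Definitions using (DecidableEquality)
open import Relation.Binary.PropositionalEquality using (_≡_; _≢_; refl; sym; trans; cong; cong₂; subst)
open import Relation.Nullary using (Dec; ¬_)
open import Relation.Nullary.Decidable using (toWitness; map′; ¬?; _→-dec_; _×-dec_)

_≟ˢ_ : DecidableEquality (Subset 7)
_≟ˢ_ = Vec-≡-dec _≟ᵇ_

_≟ᶠ²¹_ : DecidableEquality F21
_≟ᶠ²¹_ = ×-≡-dec _≟_ _≟_

all-F21? : {P : F21 → Set} → (∀ g → Dec (P g)) → Dec (∀ g → P g)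
all-F21? P? = map′ (λ h (i , b) → h i b) (λ h i b → h (i , b)) (all? λ i → all? λ b → P? (i , b))

any-F21? : {P : F21 → Set} → (∀ g → Dec (P g)) → Dec (∃ P)
any-F21? P? =
  map′ (λ (i , b , p) → (i , b) , p) (λ ((i , b) , p) → i , b , p) (any? λ i → any? λ b → P? (i , b))

mapTri : (V → V) → Triple → Triple
mapTri f (a , b , c) = (f a , f b , f c)

imgTri-≗ : ∀ σ f → (∀ x → σ ⟨$⟩ʳ x ≡ f x) → ∀ t → imgTri σ t ≡ tri (mapTri f t)
imgTri-≗ σ f σ≗f (a , b , c) = cong tri (cong₂ _,_ (σ≗f a) (cong₂ _,_ (σ≗f b) (σ≗f c)))

inClass? : ∀ fam S → Dec (InClass fam S)
inClass? fam S = any? λ x → S ≟ˢ tri (fam x)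

mapsClassOnto? : ∀ σ fam → Dec (MapsClassOnto σ fam)
mapsClassOnto? σ fam =
  (all? λ x → inClass? fam (imgTri σ (fam x))) ×-dec
  (all? λ x → any? λ y → imgTri σ (fam y) ≟ˢ tri (fam x))

perm-isGraphAut : ∀ σ → IsGraphAut σ
perm-isGraphAut σ x y =
  mk⇔ (λ x≢y σx≡σy → x≢y (Injection.injective (↔⇒↣ σ) σx≡σy))
      (λ σx≢σy x≡y → σx≢σy (cong (σ ⟨$⟩ʳ_) x≡y))

Intertwines : (V → V → V) → (V → V) → Set
Intertwines r f = ∀ x y → x ≢ y → f (rot x y) ≡ r (f x) (f y)

intertwines? : ∀ r f → Dec (Intertwines r f)
intertwines? r f = all? λ x → all? λ y → ¬? (x ≟ y) →-dec f (rot x y) ≟ r (f x) (f y)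

intertwines-resp-≗ : ∀ r {f g} → (∀ x → f x ≡ g x) → Intertwines r f → Intertwines r g
intertwines-resp-≗ r {f} {g} f≗g hf x y x≢y =
  trans (sym (f≗g (rot x y))) (trans (hf x y x≢y) (cong₂ r (f≗g x) (f≗g y)))

intertwines-of-commutes : ∀ σ → (∀ d → IsDart d → onDart σ (ρ d) ≡ ρ (onDart σ d)) →
                          Intertwines rot (σ ⟨$⟩ʳ_)
intertwines-of-commutes σ comm x y x≢y = cong proj₂ (comm (x , y) x≢y)

intertwines-of-reverses : ∀ σ → (∀ d → IsDart d → onDart σ (ρ d) ≡ ρ⁻¹ (onDart σ d)) →
                          Intertwines rotInv (σ ⟨$⟩ʳ_)
intertwines-of-reverses σ rev x y x≢y = cong proj₂ (rev (x , y) x≢y)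

ρ₀-orbit : ℕ → V
ρ₀-orbit = fold (suc zero) (rot zero)

-- ρ₀ is a bijection fixing 0.
ρ₀-orbit-nonzero : ∀ k → ρ₀-orbit k ≢ zero
ρ₀-orbit-nonzero ℕ.zero ()
ρ₀-orbit-nonzero (ℕ.suc k) ρ₀ᵏ⁺¹≡0 =
  ρ₀-orbit-nonzero k (trans (sym (rotInv-rot zero (ρ₀-orbit k))) (cong (rotInv zero) ρ₀ᵏ⁺¹≡0))

-- log₅ x is the k with 5ᵏ ≡ x (mod 7), i.e. ρ₀ᵏ(1) = x; the entry at 0 is junk.
log₅ : V → ℕ
log₅ = lookup (0 ∷ 0 ∷ 4 ∷ 5 ∷ 2 ∷ 1 ∷ 3 ∷ [])

abstract
  ρ₀-orbit-log₅ : ∀ x → x ≢ zero → ρ₀-orbit (log₅ x) ≡ x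
  ρ₀-orbit-log₅ = toWitness {a? = all? λ x → ¬? (x ≟ zero) →-dec ρ₀-orbit (log₅ x) ≟ x} tt

intertwines-on-ρ₀-orbit : ∀ r f → Intertwines r f →
                          ∀ k → f (ρ₀-orbit k) ≡ fold (f (suc zero)) (r (f zero)) k
intertwines-on-ρ₀-orbit r f hf ℕ.zero = refl
intertwines-on-ρ₀-orbit r f hf (ℕ.suc k) =
  trans (hf zero (ρ₀-orbit k) (λ 0≡ρ₀ᵏ → ρ₀-orbit-nonzero k (sym 0≡ρ₀ᵏ)))
        (cong (r (f zero)) (intertwines-on-ρ₀-orbit r f hf k))

-- The only candidate for a map intertwining ρ with r and sending 0 ↦ a, 1 ↦ b:
-- it must send ρ₀ᵏ(1) to (r a)ᵏ(b).
extend : (V → V → V) → V → V → V → V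
extend r a b zero = a
extend r a b x@(suc _) = fold b (r a) (log₅ x)

intertwines⇒≗extend : ∀ r f → Intertwines r f → ∀ x → f x ≡ extend r (f zero) (f (suc zero)) x
intertwines⇒≗extend r f hf zero = refl
intertwines⇒≗extend r f hf x@(suc _) =
  trans (cong f (sym (ρ₀-orbit-log₅ x λ ()))) (intertwines-on-ρ₀-orbit r f hf (log₅ x))

abstract
  no-reversing-extension : ∀ a b → a ≢ b → ¬ Intertwines rotInv (extend rotInv a b)
  no-reversing-extension =
    toWitness {a? = all? λ a → all? λ b → ¬? (a ≟ b) →-dec ¬? (intertwines? rotInv (extend rotInv a b))} tt

affine : F21 → V → V
affine (i , b) x = (2 ^ toℕ i * toℕ x + toℕ b) mod 7

-- 4 = 2⁻¹ and 7 ∸ b = −b in ℤ₇.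
affine⁻¹ : F21 → V → V
affine⁻¹ (i , b) y = (4 ^ toℕ i * (toℕ y + (7 ∸ toℕ b))) mod 7

abstract
  affine-inverseˡ : ∀ g y → affine g (affine⁻¹ g y) ≡ y
  affine-inverseˡ = toWitness {a? = all-F21? λ g → all? λ y → affine g (affine⁻¹ g y) ≟ y} tt

  affine-inverseʳ : ∀ g x → affine⁻¹ g (affine g x) ≡ x
  affine-inverseʳ = toWitness {a? = all-F21? λ g → all? λ x → affine⁻¹ g (affine g x) ≟ x} tt

φ : F21 → Perm
φ g = permutation (affine g) (affine⁻¹ g) (affine-inverseˡ g) (affine-inverseʳ g)

abstract
  affine-rot : ∀ g x y → affine g (rot x y) ≡ rot (affine g x) (affine g y)
  affine-rot = toWitness {a? = all-F21? λ g → all? λ x → all? λ y →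
    affine g (rot x y) ≟ rot (affine g x) (affine g y)} tt

  affine-mapsClassOnto-famA : ∀ g → MapsClassOnto (φ g) famA
  affine-mapsClassOnto-famA = toWitness {a? = all-F21? λ g → mapsClassOnto? (φ g) famA} tt

  affine-mapsClassOnto-famB : ∀ g → MapsClassOnto (φ g) famB
  affine-mapsClassOnto-famB = toWitness {a? = all-F21? λ g → mapsClassOnto? (φ g) famB} tt

  affine-· : ∀ g h x → affine (g · h) x ≡ affine g (affine h x)
  affine-· = toWitness {a? = all-F21? λ g → all-F21? λ h → all? λ x →
    affine (g · h) x ≟ affine g (affine h x)} tt

  affine-determined-by-0-1 : ∀ g h → affine g zero ≡ affine h zero →
                             affine g (suc zero) ≡ affine h (suc zero) → g ≡ h
  affine-determined-by-0-1 = toWitness {a? = all-F21? λ g → all-F21? λ h →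
    affine g zero ≟ affine h zero →-dec affine g (suc zero) ≟ affine h (suc zero) →-dec g ≟ᶠ²¹ h} tt

  colour-preserving-extension-is-affine : ∀ a b → InClass famA (tri (mapTri (extend rot a b) (famA zero))) →
                                          ∃ λ g → ∀ x → affine g x ≡ extend rot a b x
  colour-preserving-extension-is-affine = toWitness {a? = all? λ a → all? λ b →
    inClass? famA (tri (mapTri (extend rot a b) (famA zero))) →-dec
    any-F21? λ g → all? λ x → affine g x ≟ extend rot a b x} tt

φ-inAutCol : ∀ g → InAutCol (φ g)
φ-inAutCol g =
  (perm-isGraphAut (φ g) , inj₁ λ (x , y) _ → cong (affine g x ,_) (affine-rot g x y)) ,
  affine-mapsClassOnto-famA g , affine-mapsClassOnto-famB g

φ-injective : ∀ g h → (∀ x → φ g ⟨$⟩ʳ x ≡ φ h ⟨$⟩ʳ x) → g ≡ h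
φ-injective g h g≗h = affine-determined-by-0-1 g h (g≗h zero) (g≗h (suc zero))

no-reversing-graphAut : ∀ σ → IsGraphAut σ → ¬ (∀ d → IsDart d → onDart σ (ρ d) ≡ ρ⁻¹ (onDart σ d))
no-reversing-graphAut σ isAut reverses =
  no-reversing-extension (σ ⟨$⟩ʳ zero) (σ ⟨$⟩ʳ suc zero) (Equivalence.to (isAut zero (suc zero)) λ ())
    (intertwines-resp-≗ rotInv (intertwines⇒≗extend rotInv (σ ⟨$⟩ʳ_) hσ) hσ)
  where
  hσ : Intertwines rotInv (σ ⟨$⟩ʳ_)
  hσ = intertwines-of-reverses σ reverses

autCol⇒affine : ∀ σ → InAutCol σ → ∃ λ g → ∀ x → φ g ⟨$⟩ʳ x ≡ σ ⟨$⟩ʳ x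
autCol⇒affine σ ((isAut , inj₂ reverses) , _) = ⊥-elim (no-reversing-graphAut σ isAut reverses)
autCol⇒affine σ ((_ , inj₁ commutes) , (classA , _) , _) =
  g , λ x → trans (g≗ext x) (sym (σ≗ext x))
  where
  a b : V
  a = σ ⟨$⟩ʳ zero
  b = σ ⟨$⟩ʳ suc zero
  σ≗ext : ∀ x → σ ⟨$⟩ʳ x ≡ extend rot a b x
  σ≗ext = intertwines⇒≗extend rot (σ ⟨$⟩ʳ_) (intertwines-of-commutes σ commutes)
  colourA : InClass famA (tri (mapTri (extend rot a b) (famA zero)))
  colourA = subst (InClass famA) (imgTri-≗ σ _ σ≗ext (famA zero)) (classA zero)
  affine≗ext : ∃ λ g → ∀ x → affine g x ≡ extend rot a b x
  affine≗ext = colour-preserving-extension-is-affine a b colourA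
  g = proj₁ affine≗ext
  g≗ext = proj₂ affine≗ext

theorem4p4 : ∃ λ (φ : F21 → Perm) → IsIsoOntoAutCol φ
theorem4p4 = φ , φ-inAutCol , affine-· , φ-injective , autCol⇒affine
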